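{- Let $W=\{0,1/2,1\}$ and $N=\binom n2$. For charging functions $\omega$ of $K_n$ with odd total charge, $\mathrm{TS}(K_n,\omega)$ is almost full: the number of points of $\{0,1/2,1\}^N$ satisfying all inequalities of $\mathrm{TS}(K_n,\omega)$ is at least $3^N-o(3^N)$, where the $o(3^N)$ term does not depend on $\omega$.
   Context: $K_n$ is the complete graph on $n$ vertices. For a graph $G=(V,E)$ and $\omega:V\to\{0,1\}$ with $\sum_v\omega(v)\equiv 1\pmod 2$, $\mathrm{TS}(G,\omega)$ has one variable $x_e$ per edge and consists of the integer linear inequalities obtained from the CNF encoding of $\sum_{e\ni v}x_e\equiv\omega(v)\pmod 2$ for every $v\in V$ (a clause $\bigvee_{i\in P}x_i\vee\bigvee_{j\in N}\neg x_j$ becomes $\sum_{i\in P}x_i+\sum_{j\in N}(1-x_j)\geq 1$). -}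

module Defs where

open import Data.Bool using (Bool; true; false; if_then_else_; not; _∨_; _∧_)
open import Data.Nat using (ℕ; zero; suc; _<ᵇ_; _≡ᵇ_; _%_)
import Data.Nat as ℕ
open import Relation.Binary.PropositionalEquality using (_≡_)
open import Data.Fin using (Fin; toℕ)
open import Data.Product using (_×_; _,_; proj₁; proj₂)
open import Data.List using (List; []; _∷_; [_]; map; concatMap; allFin; zip; length; filterᵇ; foldr)
open import Data.Vec using (Vec; toList)
import Data.Vec as Vec
open import Data.Rational using (ℚ; 0ℚ; 1ℚ; ½; _-_; _≤ᵇ_)
import Data.Rational as ℚ

-- Edges of the complete graph K_n: unordered pairs {i,j}, listed as (i , j) with i < j.
-- Their number is n choose 2 = N.
edges : (n : ℕ) → List (Fin n × Fin n)
edges n = concatMap (λ i → concatMap (λ j → if toℕ i <ᵇ toℕ j then [ (i , j) ] else [])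
                                      (allFin n))
                    (allFin n)

numEdges : ℕ → ℕ
numEdges n = length (edges n)

W : Set
W = Fin 3

val : W → ℚ
val Fin.zero = 0ℚ
val (Fin.suc Fin.zero) = ½
val (Fin.suc (Fin.suc Fin.zero)) = 1ℚ

-- A point of W^N: one value per edge (positions follow the order of `edges n`).
Point : ℕ → Set
Point n = Vec W (numEdges n)

-- a charging function ω : V → {0,1}, with true = 1
Charge : ℕ → Set
Charge n = Fin n → Bool

bitVal : Bool → ℕ
bitVal true = 1
bitVal false = 0

OddCharge : (n : ℕ) → Charge n → Set
OddCharge n ω = foldr (λ v s → bitVal (ω v) ℕ.+ s) 0 (allFin n) % 2 ≡ 1

incidentTo : ∀ {n} → Fin n → Fin n × Fin n → Bool
incidentTo v (i , j) = (toℕ v ≡ᵇ toℕ i) ∨ (toℕ v ≡ᵇ toℕ j)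

incidentVals : ∀ {n} → Fin n → Point n → List ℚ
incidentVals {n} v x =
  map (λ p → val (proj₂ p)) (filterᵇ (λ p → incidentTo v (proj₁ p)) (zip (edges n) (toList x)))

allBools : ℕ → List (List Bool)
allBools zero = [] ∷ []
allBools (suc d) = concatMap (λ bs → (false ∷ bs) ∷ (true ∷ bs) ∷ []) (allBools d)

parity : List Bool → Bool
parity [] = false
parity (b ∷ bs) = if b then not (parity bs) else parity bs

sumℚ : List ℚ → ℚ
sumℚ = foldr ℚ._+_ 0ℚ

-- The clause ruling out the 0/1-assignment a of the variables xs:
--   ⋁_{a_i = 0} x_i ∨ ⋁_{a_i = 1} ¬x_i,
-- as the inequality Σ_{a_i=0} x_i + Σ_{a_i=1} (1 - x_i) ≥ 1.
clauseIneq : List Bool → List ℚ → Bool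
clauseIneq a xs = 1ℚ ≤ᵇ sumℚ (map (λ p → if proj₁ p then 1ℚ - proj₂ p else proj₂ p) (zip a xs))

allᵇ : {A : Set} → (A → Bool) → List A → Bool
allᵇ p = foldr (λ a b → p a ∧ b) true

eqBool : Bool → Bool → Bool
eqBool true b = b
eqBool false b = not b

-- Canonical CNF of Σ_{e∋v} x_e ≡ ω(v) (mod 2): one clause for every 0/1-assignment
-- a of the incident variables with the wrong parity.
vertexOK : ∀ {n} → Charge n → Point n → Fin n → Bool
vertexOK ω x v =
  let xs = incidentVals v x in
  allᵇ (λ a → if eqBool (parity a) (ω v) then true else clauseIneq a xs)
      (allBools (length xs))

satisfiesTS : ∀ {n} → Charge n → Point n → Bool
satisfiesTS {n} ω x = allᵇ (vertexOK ω x) (allFin n)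

allPoints : (m : ℕ) → List (Vec W m)
allPoints zero = Vec.[] ∷ []
allPoints (suc m) = concatMap (λ v → map (λ w → w Vec.∷ v) (allFin 3)) (allPoints m)

countSat : (n : ℕ) → Charge n → ℕ
countSat n ω = length (filterᵇ (satisfiesTS ω) (allPoints (numEdges n)))

-- Call an edge with value 1/2 a half edge. At a vertex with at least two incident
-- half edges every clause inequality holds: a clause sum is a sum of terms x_e or
-- 1 − x_e, all nonnegative, and each half edge contributes 1/2 whichever literal
-- it carries. So a point of {0,1/2,1}^N can violate TS(K_n, ω) only if some vertex
-- has at most one incident half edge. For a vertex of degree d = n − 1 there are
-- 3^(N−d)·2^d points with no incident half edge and 3^(N−d)·d·2^(d−1) with exactly
-- one, so by the union bound at most n·(d+2)·2^(d−1)·3^(N−d) points are violating,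
-- a fraction O(n³(2/3)ⁿ) of 3^N that does not depend on ω.
module Submission where

open import Defs
open import Data.Nat using (ℕ; _*_; _^_; _∸_; _≤_)
open import Data.Product using (∃-syntax)

open import Data.Bool using (Bool; true; false; if_then_else_; not; _∧_; _∨_; T)
open import Data.Bool.Properties using (T-∧; ∧-zeroʳ)
open import Data.Empty using (⊥-elim)
open import Data.Fin using (Fin; toℕ)
import Data.Fin.Properties as Fin
open import Data.List using (List; []; _∷_; [_]; _++_; map; zip; zipWith; length; concatMap; filterᵇ; allFin; tabulate)
import Data.List.Properties as List
open import Data.Nat using (zero; suc; z≤n; s≤s; _+_; _<_; _≡ᵇ_; _<ᵇ_; _≤ᵇ_)
import Data.Nat.Properties as ℕ
open import Data.Nat.Solver using (module +-*-Solver)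
open import Data.Product using (_×_; _,_; proj₁; proj₂)
open import Data.Rational using (ℚ; 0ℚ; 1ℚ; ½; _-_)
import Data.Rational as ℚ
import Data.Rational.Properties as ℚₚ
open import Data.Unit using (tt)
open import Data.Vec using (Vec; toList)
open import Function using (_∘_)
open import Function.Bundles using (module Equivalence)
open import Relation.Binary.PropositionalEquality hiding ([_])

open +-*-Solver

pattern w₀ = Fin.zero
pattern w½ = Fin.suc Fin.zero
pattern w₁ = Fin.suc (Fin.suc Fin.zero)

module _ {A : Set} where

  sumBy : (A → ℕ) → List A → ℕ
  sumBy f []       = 0
  sumBy f (x ∷ xs) = f x + sumBy f xs

  count : (A → Bool) → List A → ℕ
  count p = sumBy (bitVal ∘ p)

  sumBy-++ : ∀ f (xs ys : List A) → sumBy f (xs ++ ys) ≡ sumBy f xs + sumBy f ys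
  sumBy-++ f []       ys = refl
  sumBy-++ f (x ∷ xs) ys = trans (cong (f x +_) (sumBy-++ f xs ys)) (sym (ℕ.+-assoc (f x) _ _))

  sumBy-cong : ∀ {f g : A → ℕ} → (∀ x → f x ≡ g x) → ∀ xs → sumBy f xs ≡ sumBy g xs
  sumBy-cong f≗g []       = refl
  sumBy-cong f≗g (x ∷ xs) = cong₂ _+_ (f≗g x) (sumBy-cong f≗g xs)

  sumBy-mono : ∀ {f g : A → ℕ} → (∀ x → f x ≤ g x) → ∀ xs → sumBy f xs ≤ sumBy g xs
  sumBy-mono f≤g []       = z≤n
  sumBy-mono f≤g (x ∷ xs) = ℕ.+-mono-≤ (f≤g x) (sumBy-mono f≤g xs)

  sumBy-+ : ∀ f g (xs : List A) → sumBy (λ x → f x + g x) xs ≡ sumBy f xs + sumBy g xs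
  sumBy-+ f g []       = refl
  sumBy-+ f g (x ∷ xs) rewrite sumBy-+ f g xs =
    solve 4 (λ a b c d → (a :+ b) :+ (c :+ d) := (a :+ c) :+ (b :+ d)) refl
      (f x) (g x) (sumBy f xs) (sumBy g xs)

  sumBy-* : ∀ c f (xs : List A) → sumBy (λ x → c * f x) xs ≡ c * sumBy f xs
  sumBy-* c f []       = sym (ℕ.*-zeroʳ c)
  sumBy-* c f (x ∷ xs) rewrite sumBy-* c f xs = sym (ℕ.*-distribˡ-+ c (f x) (sumBy f xs))

  sumBy-const : ∀ c (xs : List A) → sumBy (λ _ → c) xs ≡ length xs * c
  sumBy-const c []       = refl
  sumBy-const c (x ∷ xs) = cong (c +_) (sumBy-const c xs)

  sumBy-1 : ∀ (xs : List A) → sumBy (λ _ → 1) xs ≡ length xs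
  sumBy-1 xs = trans (sumBy-const 1 xs) (ℕ.*-identityʳ (length xs))

  length-filterᵇ : ∀ p (xs : List A) → length (filterᵇ p xs) ≡ count p xs
  length-filterᵇ p []       = refl
  length-filterᵇ p (x ∷ xs) with p x
  ... | true  = cong suc (length-filterᵇ p xs)
  ... | false = length-filterᵇ p xs

  count-not+count : ∀ p (xs : List A) → count (not ∘ p) xs + count p xs ≡ length xs
  count-not+count p []       = refl
  count-not+count p (x ∷ xs) with p x
  ... | true  = trans (ℕ.+-suc _ _) (cong suc (count-not+count p xs))
  ... | false = cong suc (count-not+count p xs)

sumBy-map : ∀ {A B : Set} (f : B → ℕ) (g : A → B) xs → sumBy f (map g xs) ≡ sumBy (f ∘ g) xs
sumBy-map f g []       = refl
sumBy-map f g (x ∷ xs) = cong (f (g x) +_) (sumBy-map f g xs)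

sumBy-concatMap : ∀ {A B : Set} (f : B → ℕ) (g : A → List B) xs →
                  sumBy f (concatMap g xs) ≡ sumBy (sumBy f ∘ g) xs
sumBy-concatMap f g []       = refl
sumBy-concatMap f g (x ∷ xs) =
  trans (sumBy-++ f (g x) (concatMap g xs)) (cong (sumBy f (g x) +_) (sumBy-concatMap f g xs))

bitVal-implication : ∀ p q → (T p → T q) → 1 ≤ bitVal q + bitVal (not p)
bitVal-implication false q  _   = ℕ.m≤n+m 1 (bitVal q)
bitVal-implication true true  _ = s≤s z≤n
bitVal-implication true false p⇒q = ⊥-elim (p⇒q tt)

length≤count+count-not : ∀ {A : Set} {p q : A → Bool} → (∀ x → T (p x) → T (q x)) →
                         ∀ xs → length xs ≤ count q xs + count (not ∘ p) xs
length≤count+count-not {p = p} {q} p⇒q xs = begin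
  length xs                                   ≡⟨ sumBy-1 xs ⟨
  sumBy (λ _ → 1) xs                          ≤⟨ sumBy-mono (λ x → bitVal-implication (p x) (q x) (p⇒q x)) xs ⟩
  sumBy (λ x → bitVal (q x) + bitVal (not (p x))) xs ≡⟨ sumBy-+ _ _ xs ⟩
  count q xs + count (not ∘ p) xs             ∎
  where open ℕ.≤-Reasoning

count-not-allᵇ≤ : ∀ {A B : Set} (p : B → A → Bool) (xs : List A) (vs : List B) →
                  count (λ x → not (allᵇ (λ v → p v x) vs)) xs ≤ sumBy (λ v → count (not ∘ p v) xs) vs
count-not-allᵇ≤ p xs [] = ℕ.≤-reflexive (trans (sumBy-const 0 xs) (ℕ.*-zeroʳ (length xs)))
count-not-allᵇ≤ p xs (v ∷ vs) = begin
  count (λ x → not (p v x ∧ allᵇ (λ v → p v x) vs)) xs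
    ≤⟨ sumBy-mono (λ x → not-∧≤ (p v x) _) xs ⟩
  sumBy (λ x → bitVal (not (p v x)) + bitVal (not (allᵇ (λ v → p v x) vs))) xs
    ≡⟨ sumBy-+ _ _ xs ⟩
  count (not ∘ p v) xs + count (λ x → not (allᵇ (λ v → p v x) vs)) xs
    ≤⟨ ℕ.+-monoʳ-≤ (count (not ∘ p v) xs) (count-not-allᵇ≤ p xs vs) ⟩
  count (not ∘ p v) xs + sumBy (λ v → count (not ∘ p v) xs) vs ∎
  where
  open ℕ.≤-Reasoning
  not-∧≤ : ∀ a b → bitVal (not (a ∧ b)) ≤ bitVal (not a) + bitVal (not b)
  not-∧≤ true  b = ℕ.≤-refl
  not-∧≤ false b = s≤s z≤n

allᵇ-++⁺ : ∀ {A : Set} {P : A → Bool} xs {ys} → T (allᵇ P xs) → T (allᵇ P ys) → T (allᵇ P (xs ++ ys))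
allᵇ-++⁺ []       _   Pys = Pys
allᵇ-++⁺ (x ∷ xs) Pxs Pys =
  let Px , Pxs′ = Equivalence.to T-∧ Pxs in Equivalence.from T-∧ (Px , allᵇ-++⁺ xs Pxs′ Pys)

allᵇ-concatMap⁺ : ∀ {A B : Set} {P : B → Bool} (g : A → List B) xs →
                  T (allᵇ (allᵇ P ∘ g) xs) → T (allᵇ P (concatMap g xs))
allᵇ-concatMap⁺ g []       _ = tt
allᵇ-concatMap⁺ g (x ∷ xs) h =
  let Pgx , Pxs = Equivalence.to T-∧ h in allᵇ-++⁺ (g x) Pgx (allᵇ-concatMap⁺ g xs Pxs)

allᵇ-mono : ∀ {A : Set} {P Q : A → Bool} → (∀ x → T (P x) → T (Q x)) →
            ∀ xs → T (allᵇ P xs) → T (allᵇ Q xs)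
allᵇ-mono P⇒Q []       _ = tt
allᵇ-mono P⇒Q (x ∷ xs) h =
  let Px , Pxs = Equivalence.to T-∧ h in Equivalence.from T-∧ (P⇒Q x Px , allᵇ-mono P⇒Q xs Pxs)

allᵇ-allBools⁺ : ∀ {P : List Bool → Bool} d → (∀ a → length a ≡ d → T (P a)) → T (allᵇ P (allBools d))
allᵇ-allBools⁺ zero    h = Equivalence.from T-∧ (h [] refl , tt)
allᵇ-allBools⁺ (suc d) h = allᵇ-concatMap⁺ _ (allBools d) (allᵇ-allBools⁺ d λ a |a|≡d →
  Equivalence.from T-∧ (h (false ∷ a) (cong suc |a|≡d) ,
    Equivalence.from T-∧ (h (true ∷ a) (cong suc |a|≡d) , tt)))

-- Clause inequalities at a vertex with two half edges

isHalf : W → Bool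
isHalf w₀ = false
isHalf w½ = true
isHalf w₁ = false

halves : List W → ℕ
halves = count isHalf

halfBound : ℕ → ℚ
halfBound 0             = 0ℚ
halfBound 1             = ½
halfBound (suc (suc _)) = 1ℚ

0≤val : ∀ w → 0ℚ ℚ.≤ val w
0≤val w₀ = ℚₚ.≤-refl
0≤val w½ = ℚₚ.≤ᵇ⇒≤ tt
0≤val w₁ = ℚₚ.≤ᵇ⇒≤ tt

q≤p+r-nonneg : ∀ {p q r} → 0ℚ ℚ.≤ p → q ℚ.≤ r → q ℚ.≤ p ℚ.+ r
q≤p+r-nonneg {p} {q} {r} 0≤p q≤r = subst (ℚ._≤ p ℚ.+ r) (ℚₚ.+-identityˡ q) (ℚₚ.+-mono-≤ 0≤p q≤r)

halfBound-suc : ∀ h {s} → halfBound h ℚ.≤ s → halfBound (suc h) ℚ.≤ ½ ℚ.+ s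
halfBound-suc 0             {s} h≤s = subst (ℚ._≤ ½ ℚ.+ s) (ℚₚ.+-identityʳ ½) (ℚₚ.+-monoʳ-≤ ½ h≤s)
halfBound-suc 1             {s} h≤s = ℚₚ.+-monoʳ-≤ ½ {½} {s} h≤s
halfBound-suc (suc (suc _)) {s} h≤s =
  ℚₚ.+-monoʳ-≤ ½ {½} {s} (ℚₚ.≤-trans (ℚₚ.≤ᵇ⇒≤ {½} {1ℚ} tt) h≤s)

halfBound≤sum : ∀ ws → halfBound (halves ws) ℚ.≤ sumℚ (map val ws)
halfBound≤sum []        = ℚₚ.≤-refl
halfBound≤sum (w½ ∷ ws) = halfBound-suc (halves ws) (halfBound≤sum ws)
halfBound≤sum (w₀ ∷ ws) = q≤p+r-nonneg (0≤val w₀) (halfBound≤sum ws)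
halfBound≤sum (w₁ ∷ ws) = q≤p+r-nonneg (0≤val w₁) (halfBound≤sum ws)

halfBound-≥2 : ∀ {h} → 2 ≤ h → halfBound h ≡ 1ℚ
halfBound-≥2 (s≤s (s≤s _)) = refl

-- The summand of clauseIneq; the flag marks a negated literal.
clauseTerm : Bool × ℚ → ℚ
clauseTerm (b , x) = if b then 1ℚ - x else x

complementIf : Bool → W → W
complementIf false w  = w
complementIf true  w₀ = w₁
complementIf true  w½ = w½
complementIf true  w₁ = w₀

clauseTerm-val : ∀ b w → clauseTerm (b , val w) ≡ val (complementIf b w)
clauseTerm-val false w  = refl
clauseTerm-val true  w₀ = refl
clauseTerm-val true  w½ = refl
clauseTerm-val true  w₁ = refl

sum-clauseTerm : ∀ a ws → sumℚ (map clauseTerm (zip a (map val ws))) ≡ sumℚ (map val (zipWith complementIf a ws))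
sum-clauseTerm []      ws       = refl
sum-clauseTerm (b ∷ a) []       = refl
sum-clauseTerm (b ∷ a) (w ∷ ws) = cong₂ ℚ._+_ (clauseTerm-val b w) (sum-clauseTerm a ws)

halves-complementIf : ∀ a ws → length a ≡ length ws → halves (zipWith complementIf a ws) ≡ halves ws
halves-complementIf []      []       _ = refl
halves-complementIf (b ∷ a) (w ∷ ws) e =
  cong₂ _+_ (isHalf-complementIf b w) (halves-complementIf a ws (ℕ.suc-injective e))
  where
  isHalf-complementIf : ∀ b w → bitVal (isHalf (complementIf b w)) ≡ bitVal (isHalf w)
  isHalf-complementIf false w  = refl
  isHalf-complementIf true  w₀ = refl
  isHalf-complementIf true  w½ = refl
  isHalf-complementIf true  w₁ = refl

clauseIneq-holds : ∀ a ws → length a ≡ length ws → 2 ≤ halves ws → T (clauseIneq a (map val ws))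
clauseIneq-holds a ws |a|≡|ws| 2≤halves = ℚₚ.≤⇒≤ᵇ (begin
  1ℚ                                            ≡⟨ sym (halfBound-≥2 2≤halves′) ⟩
  halfBound (halves (zipWith complementIf a ws)) ≤⟨ halfBound≤sum (zipWith complementIf a ws) ⟩
  sumℚ (map val (zipWith complementIf a ws))    ≡⟨ sym (sum-clauseTerm a ws) ⟩
  sumℚ (map clauseTerm (zip a (map val ws)))    ∎)
  where
  open ℚₚ.≤-Reasoning
  2≤halves′ = subst (2 ≤_) (sym (halves-complementIf a ws |a|≡|ws|)) 2≤halves

select : ∀ {A : Set} → List Bool → List A → List A
select (true  ∷ m) (x ∷ xs) = x ∷ select m xs
select (false ∷ m) (x ∷ xs) = select m xs
select _           _        = []

incidence : ∀ {n} → Fin n → List Bool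
incidence {n} v = map (incidentTo v) (edges n)

halvesOn : ∀ {m} → List Bool → Vec W m → ℕ
halvesOn mask x = halves (select mask (toList x))

halved : ∀ {n} → Fin n → Point n → Bool
halved v x = 2 ≤ᵇ halvesOn (incidence v) x

allHalved : ∀ {n} → Point n → Bool
allHalved {n} x = allᵇ (λ v → halved v x) (allFin n)

map-filterᵇ-zip : ∀ {E : Set} (f : E → Bool) es (ws : List W) →
  map (val ∘ proj₂) (filterᵇ (f ∘ proj₁) (zip es ws)) ≡ map val (select (map f es) ws)
map-filterᵇ-zip f []       ws = refl
map-filterᵇ-zip f (e ∷ es) [] with f e
... | true  = refl
... | false = refl
map-filterᵇ-zip f (e ∷ es) (w ∷ ws) with f e
... | true  = cong (val w ∷_) (map-filterᵇ-zip f es ws)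
... | false = map-filterᵇ-zip f es ws

vertexOK-halved : ∀ {n} (ω : Charge n) (x : Point n) v → T (halved v x) → T (vertexOK ω x v)
vertexOK-halved {n} ω x v h
  rewrite map-filterᵇ-zip (incidentTo v) (edges n) (toList x) = allᵇ-allBools⁺ _ clause
  where
  ws = select (incidence v) (toList x)
  clause : ∀ a → length a ≡ length (map val ws) →
           T (if eqBool (parity a) (ω v) then true else clauseIneq a (map val ws))
  clause a |a|≡|ws| with eqBool (parity a) (ω v)
  ... | true  = tt
  ... | false = clauseIneq-holds a ws (trans |a|≡|ws| (List.length-map val ws)) (ℕ.≤ᵇ⇒≤ 2 _ h)

satisfiesTS-allHalved : ∀ {n} (ω : Charge n) (x : Point n) → T (allHalved {n} x) → T (satisfiesTS ω x)
satisfiesTS-allHalved {n} ω x = allᵇ-mono {P = λ v → halved v x} (vertexOK-halved {n} ω x) (allFin n)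

-- Counting points with few half edges on a mask

ons offs : List Bool → ℕ
ons  = count (λ b → b)
offs = count not

length-allPoints : ∀ m → length (allPoints m) ≡ 3 ^ m
length-allPoints zero    = refl
length-allPoints (suc m) = begin
  length (allPoints (suc m))        ≡⟨ sym (sumBy-1 (allPoints (suc m))) ⟩
  sumBy (λ _ → 1) (allPoints (suc m)) ≡⟨ sumBy-concatMap _ _ (allPoints m) ⟩
  sumBy (λ _ → 3) (allPoints m)     ≡⟨ sumBy-const 3 (allPoints m) ⟩
  length (allPoints m) * 3          ≡⟨ cong (_* 3) (length-allPoints m) ⟩
  3 ^ m * 3                         ≡⟨ ℕ.*-comm (3 ^ m) 3 ⟩
  3 ^ suc m                         ∎
  where open ≡-Reasoning

pointsWithHalves : ℕ → List Bool → ℕ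
pointsWithHalves c mask = count (λ x → halvesOn mask x ≡ᵇ c) (allPoints (length mask))

noHalf oneHalf : List Bool → ℕ
noHalf  = pointsWithHalves 0
oneHalf = pointsWithHalves 1

pointsWithHalves-false : ∀ c mask → pointsWithHalves c (false ∷ mask) ≡ 3 * pointsWithHalves c mask
pointsWithHalves-false c mask =
  trans (sumBy-concatMap _ _ points) (sumBy-* 3 (λ x → bitVal (halvesOn mask x ≡ᵇ c)) points)
  where points = allPoints (length mask)

noHalf-true : ∀ mask → noHalf (true ∷ mask) ≡ 2 * noHalf mask
noHalf-true mask =
  trans (sumBy-concatMap _ _ points) (sumBy-* 2 (λ x → bitVal (halvesOn mask x ≡ᵇ 0)) points)
  where points = allPoints (length mask)

pointsWithHalves-true : ∀ c mask →
  pointsWithHalves (suc c) (true ∷ mask) ≡ 2 * pointsWithHalves (suc c) mask + pointsWithHalves c mask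
pointsWithHalves-true c mask = begin
  pointsWithHalves (suc c) (true ∷ mask)
    ≡⟨ sumBy-concatMap _ _ points ⟩
  sumBy (λ x → bitVal (more x) + (bitVal (exact x) + (bitVal (more x) + 0))) points
    ≡⟨ sumBy-cong (λ x → solve 2 (λ a b → a :+ (b :+ (a :+ con 0)) := con 2 :* a :+ b) refl
                                  (bitVal (more x)) (bitVal (exact x))) points ⟩
  sumBy (λ x → 2 * bitVal (more x) + bitVal (exact x)) points
    ≡⟨ sumBy-+ _ _ points ⟩
  sumBy (λ x → 2 * bitVal (more x)) points + pointsWithHalves c mask
    ≡⟨ cong (_+ pointsWithHalves c mask) (sumBy-* 2 _ points) ⟩
  2 * pointsWithHalves (suc c) mask + pointsWithHalves c mask ∎
  where
  open ≡-Reasoning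
  points = allPoints (length mask)
  more exact : Vec W (length mask) → Bool
  more  x = halvesOn mask x ≡ᵇ suc c
  exact x = halvesOn mask x ≡ᵇ c

noHalf≡ : ∀ mask → noHalf mask ≡ 3 ^ offs mask * 2 ^ ons mask
noHalf≡ []             = refl
noHalf≡ (false ∷ mask) = begin
  noHalf (false ∷ mask)             ≡⟨ pointsWithHalves-false 0 mask ⟩
  3 * noHalf mask                   ≡⟨ cong (3 *_) (noHalf≡ mask) ⟩
  3 * (3 ^ offs mask * 2 ^ ons mask) ≡⟨ ℕ.*-assoc 3 (3 ^ offs mask) (2 ^ ons mask) ⟨
  3 ^ suc (offs mask) * 2 ^ ons mask ∎
  where open ≡-Reasoning
noHalf≡ (true ∷ mask) = begin
  noHalf (true ∷ mask)               ≡⟨ noHalf-true mask ⟩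
  2 * noHalf mask                    ≡⟨ cong (2 *_) (noHalf≡ mask) ⟩
  2 * (3 ^ offs mask * 2 ^ ons mask)  ≡⟨ solve 2 (λ a b → con 2 :* (a :* b) := a :* (con 2 :* b)) refl
                                                (3 ^ offs mask) (2 ^ ons mask) ⟩
  3 ^ offs mask * 2 ^ suc (ons mask) ∎
  where open ≡-Reasoning

twiceOneHalf≡ : ∀ mask → 2 * oneHalf mask ≡ 3 ^ offs mask * (ons mask * 2 ^ ons mask)
twiceOneHalf≡ []             = refl
twiceOneHalf≡ (false ∷ mask) = begin
  2 * oneHalf (false ∷ mask)           ≡⟨ cong (2 *_) (pointsWithHalves-false 1 mask) ⟩
  2 * (3 * oneHalf mask)               ≡⟨ solve 1 (λ a → con 2 :* (con 3 :* a) := con 3 :* (con 2 :* a)) refl (oneHalf mask) ⟩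
  3 * (2 * oneHalf mask)               ≡⟨ cong (3 *_) (twiceOneHalf≡ mask) ⟩
  3 * (3 ^ offs mask * (ons mask * 2 ^ ons mask)) ≡⟨ ℕ.*-assoc 3 (3 ^ offs mask) _ ⟨
  3 ^ suc (offs mask) * (ons mask * 2 ^ ons mask) ∎
  where open ≡-Reasoning
twiceOneHalf≡ (true ∷ mask) = begin
  2 * oneHalf (true ∷ mask)                     ≡⟨ cong (2 *_) (pointsWithHalves-true 0 mask) ⟩
  2 * (2 * oneHalf mask + noHalf mask)          ≡⟨ ℕ.*-distribˡ-+ 2 (2 * oneHalf mask) (noHalf mask) ⟩
  2 * (2 * oneHalf mask) + 2 * noHalf mask      ≡⟨ cong₂ (λ a b → 2 * a + 2 * b) (twiceOneHalf≡ mask) (noHalf≡ mask) ⟩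
  2 * (p * (t * q)) + 2 * (p * q)               ≡⟨ solve 3 (λ p q t → con 2 :* (p :* (t :* q)) :+ con 2 :* (p :* q)
                                                            := p :* ((con 1 :+ t) :* (con 2 :* q))) refl p q t ⟩
  p * (suc t * 2 ^ suc t)                       ∎
  where
  open ≡-Reasoning
  p = 3 ^ offs mask
  q = 2 ^ ons mask
  t = ons mask

count-halvesOn<2 : ∀ mask {m} → length mask ≡ m →
                   2 * count (λ (x : Vec W m) → not (2 ≤ᵇ halvesOn mask x)) (allPoints m)
                     ≡ 3 ^ offs mask * ((ons mask + 2) * 2 ^ ons mask)
count-halvesOn<2 mask refl = begin
  2 * count (λ x → not (2 ≤ᵇ halvesOn mask x)) points
    ≡⟨ cong (2 *_) (trans (sumBy-cong (λ x → <2⇒≡0∨≡1 (halvesOn mask x)) points) (sumBy-+ _ _ points)) ⟩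
  2 * (noHalf mask + oneHalf mask)
    ≡⟨ solve 2 (λ a b → con 2 :* (a :+ b) := con 2 :* a :+ con 2 :* b) refl (noHalf mask) (oneHalf mask) ⟩
  2 * noHalf mask + 2 * oneHalf mask
    ≡⟨ cong₂ (λ a b → 2 * a + b) (noHalf≡ mask) (twiceOneHalf≡ mask) ⟩
  2 * (p * q) + p * (t * q)
    ≡⟨ solve 3 (λ p q t → con 2 :* (p :* q) :+ p :* (t :* q) := p :* ((t :+ con 2) :* q)) refl p q t ⟩
  p * ((t + 2) * q) ∎
  where
  open ≡-Reasoning
  points = allPoints (length mask)
  p = 3 ^ offs mask
  q = 2 ^ ons mask
  t = ons mask
  <2⇒≡0∨≡1 : ∀ h → bitVal (not (2 ≤ᵇ h)) ≡ bitVal (h ≡ᵇ 0) + bitVal (h ≡ᵇ 1)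
  <2⇒≡0∨≡1 0             = refl
  <2⇒≡0∨≡1 1             = refl
  <2⇒≡0∨≡1 (suc (suc h)) = refl

-- Degrees in K_n

sumRange : ℕ → (ℕ → ℕ) → ℕ
sumRange zero    g = 0
sumRange (suc n) g = g 0 + sumRange n (g ∘ suc)

sumRange-cong : ∀ n {f g : ℕ → ℕ} → (∀ i → f i ≡ g i) → sumRange n f ≡ sumRange n g
sumRange-cong zero    f≗g = refl
sumRange-cong (suc n) f≗g = cong₂ _+_ (f≗g 0) (sumRange-cong n (f≗g ∘ suc))

sumRange-0 : ∀ n → sumRange n (λ _ → 0) ≡ 0
sumRange-0 zero    = refl
sumRange-0 (suc n) = sumRange-0 n

sumRange-1 : ∀ n → sumRange n (λ _ → 1) ≡ n
sumRange-1 zero    = refl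
sumRange-1 (suc n) = cong suc (sumRange-1 n)

sumBy-tabulate : ∀ {n} {A : Set} (f : A → ℕ) (h : Fin n → A) (g : ℕ → ℕ) →
                 (∀ i → f (h i) ≡ g (toℕ i)) → sumBy f (tabulate h) ≡ sumRange n g
sumBy-tabulate {zero}  f h g eq = refl
sumBy-tabulate {suc n} f h g eq =
  cong₂ _+_ (eq Fin.zero) (sumBy-tabulate f (h ∘ Fin.suc) (g ∘ suc) (eq ∘ Fin.suc))

sumRange-≡ᵇ : ∀ {n v} → v < n → sumRange n (λ j → bitVal (v ≡ᵇ j)) ≡ 1
sumRange-≡ᵇ {suc n} {zero}  _         = cong suc (sumRange-0 n)
sumRange-≡ᵇ {suc n} {suc v} (s≤s v<n) = sumRange-≡ᵇ v<n

incident : ℕ → ℕ → ℕ → ℕ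
incident v i j = bitVal ((i <ᵇ j) ∧ ((v ≡ᵇ i) ∨ (v ≡ᵇ j)))

sumRange-incident : ∀ {n v} → v < n → sumRange n (λ i → sumRange n (incident v i)) ≡ n ∸ 1
sumRange-incident {suc n} {zero} _ = begin
  sumRange n (λ _ → 1) + sumRange n (λ i → sumRange (suc n) (incident 0 (suc i)))
    ≡⟨ cong₂ _+_ (sumRange-1 n) (sumRange-cong n λ i →
         trans (sumRange-cong n λ j → cong bitVal (∧-zeroʳ (i <ᵇ j))) (sumRange-0 n)) ⟩
  n + sumRange n (λ _ → 0)
    ≡⟨ trans (cong (n +_) (sumRange-0 n)) (ℕ.+-identityʳ n) ⟩
  n ∎
  where open ≡-Reasoning
sumRange-incident {suc (suc n)} {suc v} (s≤s v<n) = cong₂ _+_ (sumRange-≡ᵇ v<n) (sumRange-incident v<n)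

count-if : ∀ {E : Set} (p : E → Bool) c e → count p (if c then [ e ] else []) ≡ bitVal (c ∧ p e)
count-if p true  e = ℕ.+-identityʳ _
count-if p false e = refl

degree : ∀ {n} (v : Fin n) → ons (incidence v) ≡ n ∸ 1
degree {n} v = begin
  ons (incidence v)                                          ≡⟨ sumBy-map _ (incidentTo v) (edges n) ⟩
  count (incidentTo v) (edges n)                             ≡⟨ sumBy-concatMap _ _ (allFin n) ⟩
  sumBy (count (incidentTo v) ∘ row) (allFin n)              ≡⟨ sumBy-tabulate _ _ _ rowDegree ⟩
  sumRange n (λ i → sumRange n (incident (toℕ v) i))         ≡⟨ sumRange-incident (Fin.toℕ<n v) ⟩
  n ∸ 1                                                      ∎
  where
  open ≡-Reasoning
  row : Fin n → List (Fin n × Fin n)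
  row i = concatMap (λ j → if toℕ i <ᵇ toℕ j then [ (i , j) ] else []) (allFin n)
  rowDegree : ∀ i → count (incidentTo v) (row i) ≡ sumRange n (incident (toℕ v) (toℕ i))
  rowDegree i = trans (sumBy-concatMap _ _ (allFin n))
                      (sumBy-tabulate _ _ _ (λ j → count-if (incidentTo v) _ (i , j)))

length-incidence : ∀ {n} (v : Fin n) → length (incidence v) ≡ numEdges n
length-incidence {n} v = List.length-map (incidentTo v) (edges n)

offs+ons-incidence : ∀ {n} (v : Fin n) → offs (incidence v) + ons (incidence v) ≡ numEdges n
offs+ons-incidence v = trans (count-not+count (λ b → b) (incidence v)) (length-incidence v)

offs-incidence : ∀ {n} (v : Fin n) → offs (incidence v) ≡ numEdges n ∸ (n ∸ 1)
offs-incidence {n} v = begin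
  offs (incidence v)                                         ≡⟨ ℕ.m+n∸n≡m _ (ons (incidence v)) ⟨
  offs (incidence v) + ons (incidence v) ∸ ons (incidence v) ≡⟨ cong₂ _∸_ (offs+ons-incidence v) (degree v) ⟩
  numEdges n ∸ (n ∸ 1)                                       ∎
  where open ≡-Reasoning

degree≤numEdges : ∀ {n} (v : Fin n) → n ∸ 1 ≤ numEdges n
degree≤numEdges v =
  subst₂ _≤_ (degree v) (offs+ons-incidence v) (ℕ.m≤n+m (ons (incidence v)) (offs (incidence v)))

-- The union bound

count-unhalved : ∀ {n} (v : Fin n) →
  2 * count (not ∘ halved v) (allPoints (numEdges n)) ≡ 3 ^ (numEdges n ∸ (n ∸ 1)) * ((n ∸ 1 + 2) * 2 ^ (n ∸ 1))
count-unhalved v = trans (count-halvesOn<2 (incidence v) (length-incidence v))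
                         (cong₂ (λ f t → 3 ^ f * ((t + 2) * 2 ^ t)) (offs-incidence v) (degree v))

unsatisfied≤unhalved : ∀ {n} (ω : Charge n) →
  3 ^ numEdges n ∸ countSat n ω ≤ count (not ∘ allHalved {n}) (allPoints (numEdges n))
unsatisfied≤unhalved {n} ω = ℕ.m≤n+o⇒m∸n≤o _ _
  (subst₂ (λ a b → a ≤ b + count (not ∘ allHalved {n}) points)
          (length-allPoints (numEdges n)) (sym (length-filterᵇ (satisfiesTS ω) points))
          (length≤count+count-not (satisfiesTS-allHalved ω) points))
  where points = allPoints (numEdges n)

twice-unsatisfied≤ : ∀ {n} (ω : Charge n) →
  2 * (3 ^ numEdges n ∸ countSat n ω) ≤ n * (3 ^ (numEdges n ∸ (n ∸ 1)) * ((n ∸ 1 + 2) * 2 ^ (n ∸ 1)))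
twice-unsatisfied≤ {n} ω = begin
  2 * (3 ^ numEdges n ∸ countSat n ω)
    ≤⟨ ℕ.*-monoʳ-≤ 2 (unsatisfied≤unhalved ω) ⟩
  2 * count (not ∘ allHalved {n}) points
    ≤⟨ ℕ.*-monoʳ-≤ 2 (count-not-allᵇ≤ halved points (allFin n)) ⟩
  2 * sumBy (λ v → count (not ∘ halved v) points) (allFin n)
    ≡⟨ sumBy-* 2 _ (allFin n) ⟨
  sumBy (λ v → 2 * count (not ∘ halved v) points) (allFin n)
    ≡⟨ sumBy-cong count-unhalved (allFin n) ⟩
  sumBy (λ _ → K) (allFin n)
    ≡⟨ sumBy-const K (allFin n) ⟩
  length (allFin n) * K
    ≡⟨ cong (_* K) (List.length-tabulate {n = n} (λ i → i)) ⟩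
  n * K ∎
  where
  open ℕ.≤-Reasoning
  points = allPoints (numEdges n)
  K = 3 ^ (numEdges n ∸ (n ∸ 1)) * ((n ∸ 1 + 2) * 2 ^ (n ∸ 1))

growth : ℕ → ℕ
growth d = (d + 1) * (d + 2) * 2 ^ d

-- The ratio of consecutive terms of (d + 3) · growth d is 2(d + 4)/(d + 1) ≤ 3 from d = 5 on.
[d+3]*growth≤45*3^d : ∀ d → (d + 3) * growth d ≤ 45 * 3 ^ d
[d+3]*growth≤45*3^d 0 = ℕ.≤ᵇ⇒≤ _ _ tt
[d+3]*growth≤45*3^d 1 = ℕ.≤ᵇ⇒≤ _ _ tt
[d+3]*growth≤45*3^d 2 = ℕ.≤ᵇ⇒≤ _ _ tt
[d+3]*growth≤45*3^d 3 = ℕ.≤ᵇ⇒≤ _ _ tt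
[d+3]*growth≤45*3^d 4 = ℕ.≤ᵇ⇒≤ _ _ tt
[d+3]*growth≤45*3^d (suc (suc (suc (suc (suc u))))) = from5 u
  where
  open ℕ.≤-Reasoning
  from5 : ∀ u → (5 + u + 3) * growth (5 + u) ≤ 45 * 3 ^ (5 + u)
  from5 zero    = ℕ.≤ᵇ⇒≤ _ _ tt
  from5 (suc u) = begin
    (6 + u + 3) * growth (6 + u)
      ≡⟨ solve 2 (λ c u → (con 6 :+ u :+ con 3) :* ((con 6 :+ u :+ con 1) :* (con 6 :+ u :+ con 2) :* (con 2 :* c))
                        := (con 2 :* u :+ con 18) :* ((u :+ con 7) :* (u :+ con 8) :* c)) refl c u ⟩
    (2 * u + 18) * ((u + 7) * (u + 8) * c)
      ≤⟨ ℕ.*-monoˡ-≤ ((u + 7) * (u + 8) * c) (ℕ.m≤n+m (2 * u + 18) u) ⟩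
    (u + (2 * u + 18)) * ((u + 7) * (u + 8) * c)
      ≡⟨ solve 2 (λ c u → (u :+ (con 2 :* u :+ con 18)) :* ((u :+ con 7) :* (u :+ con 8) :* c)
                        := con 3 :* ((con 5 :+ u :+ con 3) :* ((con 5 :+ u :+ con 1) :* (con 5 :+ u :+ con 2) :* c))) refl c u ⟩
    3 * ((5 + u + 3) * growth (5 + u))
      ≤⟨ ℕ.*-monoʳ-≤ 3 (from5 u) ⟩
    3 * (45 * 3 ^ (5 + u))
      ≡⟨ solve 1 (λ x → con 3 :* (con 45 :* x) := con 45 :* (con 3 :* x)) refl (3 ^ (5 + u)) ⟩
    45 * 3 ^ (6 + u) ∎
    where c = 2 ^ (5 + u)

k*growth≤3^d : ∀ k d → 45 * k ≤ d + 3 → k * growth d ≤ 3 ^ d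
k*growth≤3^d k d 45k≤d+3 = ℕ.*-cancelˡ-≤ 45 (begin
  45 * (k * growth d)   ≡⟨ ℕ.*-assoc 45 k (growth d) ⟨
  45 * k * growth d     ≤⟨ ℕ.*-monoˡ-≤ (growth d) 45k≤d+3 ⟩
  (d + 3) * growth d    ≤⟨ [d+3]*growth≤45*3^d d ⟩
  45 * 3 ^ d            ∎)
  where open ℕ.≤-Reasoning

mainTheorem16 : (k : ℕ) → ∃[ n₀ ] ((n : ℕ) → n₀ ≤ n → (ω : Charge n) → OddCharge n ω →
                  k * (3 ^ numEdges n ∸ countSat n ω) ≤ 3 ^ numEdges n)
mainTheorem16 k = suc (45 * k) , bound
  where
  -- The bound holds for every charging function.
  bound : (n : ℕ) → suc (45 * k) ≤ n → (ω : Charge n) → OddCharge n ω →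
          k * (3 ^ numEdges n ∸ countSat n ω) ≤ 3 ^ numEdges n
  bound (suc d) (s≤s 45k≤d) ω _ = ℕ.*-cancelˡ-≤ 2 (begin
    2 * (k * U)
      ≡⟨ solve 2 (λ k U → con 2 :* (k :* U) := k :* (con 2 :* U)) refl k U ⟩
    k * (2 * U)
      ≤⟨ ℕ.*-monoʳ-≤ k (twice-unsatisfied≤ ω) ⟩
    k * (suc d * (3 ^ (N ∸ d) * ((d + 2) * 2 ^ d)))
      ≡⟨ solve 4 (λ k d p q → k :* ((con 1 :+ d) :* (p :* ((d :+ con 2) :* q)))
                            := p :* (k :* ((d :+ con 1) :* (d :+ con 2) :* q))) refl k d (3 ^ (N ∸ d)) (2 ^ d) ⟩
    3 ^ (N ∸ d) * (k * growth d)
      ≤⟨ ℕ.*-monoʳ-≤ (3 ^ (N ∸ d)) (k*growth≤3^d k d (ℕ.≤-trans 45k≤d (ℕ.m≤m+n d 3))) ⟩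
    3 ^ (N ∸ d) * 3 ^ d
      ≡⟨ ℕ.^-distribˡ-+-* 3 (N ∸ d) d ⟨
    3 ^ (N ∸ d + d)
      ≡⟨ cong (3 ^_) (ℕ.m∸n+n≡m (degree≤numEdges {suc d} Fin.zero)) ⟩
    3 ^ N
      ≤⟨ ℕ.m≤m+n (3 ^ N) _ ⟩
    2 * 3 ^ N ∎)
    where
    open ℕ.≤-Reasoning
    N = numEdges (suc d)
    U = 3 ^ N ∸ countSat (suc d) ω
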